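{- A tree $T$ has no full star-cutset if and only if $T$ is a path on at most $4$ vertices. A chandelier has no full star-cutset if and only if it is a luxury chandelier.
   Context: A full star-cutset in a connected graph $G$ is a set $N[u]=\{u\}\cup N(u)$ whose removal disconnects $G$. A chandelier is a graph obtained from a tree $T$ by adding a vertex (the pivot) adjacent to every leaf of $T$; it is a luxury chandelier if in $T$ the neighbor of each leaf has degree two. -}

module Defs where

open import Data.Nat using (ℕ; zero; suc; _≤_; _≡ᵇ_)
open import Data.Bool using (Bool; true; false; _∨_; if_then_else_)
open import Data.Bool.Properties using (∨-comm)
open import Data.Fin using (Fin; zero; suc; toℕ)
open import Data.List using (List; map; allFin)
open import Data.Nat.ListAction using (sum)
open import Data.Product using (Σ; ∃; _×_; _,_)
open import Data.Sum using (_⊎_)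
open import Data.Unit using (⊤)
open import Data.Empty using (⊥)
open import Relation.Nullary using (¬_)
open import Relation.Binary.PropositionalEquality using (_≡_; refl; sym)
open import Function.Definitions using (Injective)
open import Function.Bundles using (_↔_; Inverse)

record Graph (n : ℕ) : Set where
  field
    adj    : Fin n → Fin n → Bool
    adj-sym    : ∀ x y → adj x y ≡ adj y x
    adj-irrefl : ∀ x → adj x x ≡ false

open Graph public

module _ {n : ℕ} (G : Graph n) where

  Adj : Fin n → Fin n → Set
  Adj x y = adj G x y ≡ true

  degree : Fin n → ℕ
  degree x = sum (map (λ y → if adj G x y then 1 else 0) (allFin n))

  data ReachIn (S : Fin n → Set) : Fin n → Fin n → Set where
    here : ∀ {x} → S x → ReachIn S x x
    step : ∀ {x y z} → S x → Adj x y → ReachIn S y z → ReachIn S x z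

  Connected : Set
  Connected = Fin n × (∀ x y → ReachIn (λ _ → ⊤) x y)

  record Cycle : Set where
    field
      len     : ℕ
      len≥3   : 3 ≤ len
      vtx     : Fin len → Fin n
      vtx-inj : Injective _≡_ _≡_ vtx
      consec  : ∀ (i j : Fin len) → suc (toℕ i) ≡ toℕ j → Adj (vtx i) (vtx j)
      closing : ∀ (i j : Fin len) → suc (toℕ i) ≡ len → toℕ j ≡ 0 → Adj (vtx i) (vtx j)

  Acyclic : Set
  Acyclic = ¬ Cycle

  IsTree : Set
  IsTree = Connected × Acyclic

  ClosedNbhd : Fin n → Fin n → Set
  ClosedNbhd u x = (x ≡ u) ⊎ Adj u x

  -- removing N[u] disconnects G: two vertices outside N[u] not joined by
  -- a walk in G - N[u]
  IsFullStarCutset : Fin n → Set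
  IsFullStarCutset u =
    Σ (Fin n) λ x → Σ (Fin n) λ y →
      ¬ ClosedNbhd u x × ¬ ClosedNbhd u y ×
      ¬ ReachIn (λ z → ¬ ClosedNbhd u z) x y

  HasFullStarCutset : Set
  HasFullStarCutset = Σ (Fin n) IsFullStarCutset

  IsLeaf : Fin n → Set
  IsLeaf x = degree x ≡ 1

  Luxury : Set
  Luxury = ∀ x y → IsLeaf x → Adj x y → degree y ≡ 2

_≅_ : ∀ {n m} → Graph n → Graph m → Set
_≅_ {n} {m} G H =
  Σ (Fin n ↔ Fin m) λ f → ∀ x y → adj H (Inverse.to f x) (Inverse.to f y) ≡ adj G x y

private
  succ-neq : ∀ k → (suc k ≡ᵇ k) ≡ false
  succ-neq zero = refl
  succ-neq (suc k) = succ-neq k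

pathAdj : ∀ {n} → Fin n → Fin n → Bool
pathAdj i j = (suc (toℕ i) ≡ᵇ toℕ j) ∨ (suc (toℕ j) ≡ᵇ toℕ i)

pathGraph : (n : ℕ) → Graph n
pathGraph n = record
  { adj = pathAdj
  ; adj-sym = λ x y → ∨-comm (suc (toℕ x) ≡ᵇ toℕ y) (suc (toℕ y) ≡ᵇ toℕ x)
  ; adj-irrefl = λ x → irr (toℕ x)
  }
  where
    irr : ∀ k → ((suc k ≡ᵇ k) ∨ (suc k ≡ᵇ k)) ≡ false
    irr k with suc k ≡ᵇ k | succ-neq k
    ... | false | _ = refl

-- The chandelier of a tree T: T plus a pivot (vertex zero) adjacent to
-- exactly the leaves of T (vertex suc i corresponds to vertex i of T)

chandelier : ∀ {m} → Graph m → Graph (suc m)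
chandelier {m} T = record { adj = a ; adj-sym = s ; adj-irrefl = r }
  where
    leaf : Fin m → Bool
    leaf i = degree T i ≡ᵇ 1
    a : Fin (suc m) → Fin (suc m) → Bool
    a zero zero = false
    a zero (suc j) = leaf j
    a (suc i) zero = leaf i
    a (suc i) (suc j) = adj T i j
    s : ∀ x y → a x y ≡ a y x
    s zero zero = refl
    s zero (suc j) = refl
    s (suc i) zero = refl
    s (suc i) (suc j) = adj-sym T i j
    r : ∀ x → a x x ≡ false
    r zero = refl
    r (suc i) = adj-irrefl T i

module Submission where

-- Everything rests on two facts about paths (walks without repeated vertex,
-- obtained from walks by shortcutting) in an acyclic graph: they are induced,
-- and two neighbours of a vertex v cannot be joined by a walk avoiding v.
--
-- Without a full star-cutset no vertex has three neighbours a, b, c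
-- (N[a] would separate b from c) and no path has five vertices p₀ … p₄ (N[p₂]
-- would separate p₀ from p₄).  A path maximal at both ends then visits every
-- vertex, and an acyclic graph with a spanning path is that path: P_n, n ≤ 4.
-- Conversely, in P_n with n ≤ 4 any two vertices outside a closed neighbourhood
-- are equal or adjacent (checked by computation), which is isomorphism invariant.
--
-- If the neighbour y of a leaf x had two further neighbours a, b,
-- N[x] would separate them; y cannot have x as its only neighbour when T has at
-- least three vertices.  Conversely, for luxury T no centre works: not the pivot
-- (leaves are never inside a path of T), not a leaf t (paths of T between vertices
-- outside N[t] avoid N[t]), not a non-leaf t (all vertices reach the pivot).

open import Defs
open import Data.Nat using (ℕ; zero; suc; _+_; _∸_; _≤_; _<_; z≤n; s≤s; _≡ᵇ_)
open import Data.Nat.Properties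
  using (+-assoc; +-comm; +-suc; +-identityʳ; +-mono-≤; +-monoʳ-≤; +-cancelˡ-≡; +-∸-assoc;
         ≤-refl; ≤-reflexive; ≤-trans; ≤-antisym; ≤-pred; <⇒≤; <⇒≱; ≤-<-connex; <-cmp;
         n≤1+n; m≤n⇒m≤1+n; m≤n⇒m<n∨m≡n; m≤n+m; 1+n≰n; m∸n≤m; n∸n≡0; m∸[m∸n]≡n;
         ∸-cancelˡ-≡; m+[n∸m]≡n; m+n≤o⇒m≤o∸n; suc-injective; anyUpTo?; ≡ᵇ⇒≡; ≡⇒≡ᵇ)
  renaming (_≟_ to _≟ℕ_)
open import Data.Bool using (Bool; true; false; not; _∧_; _∨_; if_then_else_)
open import Data.Bool.Properties using (T-∨; T-≡; ⇔→≡) renaming (_≟_ to _≟ᵇ_)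
open import Data.Fin using (Fin; zero; suc; toℕ; fromℕ<)
open import Data.Fin.Properties
  using (_≟_; any?; all?; toℕ-injective; toℕ<n; toℕ-fromℕ<; injective⇒≤)
import Data.Fin.Properties as Finₚ
open import Data.List using (List; []; _∷_; length; map; tabulate)
open import Data.List.Relation.Unary.All using (All; []; _∷_)
import Data.List.Relation.Unary.All as All
open import Data.List.Relation.Unary.Any using (here; there)
import Data.List.Relation.Unary.Any as Any
open import Data.List.Membership.Propositional using (_∈_; _∉_)
open import Data.List.Relation.Unary.Unique.Propositional using (Unique; []; _∷_)
open import Data.Nat.ListAction using (sum)
open import Data.Product using (Σ; _×_; _,_; proj₁; proj₂)
open import Data.Sum using (_⊎_; inj₁; inj₂) renaming (map to ⊎-map)
open import Data.Empty using (⊥; ⊥-elim)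
open import Data.Unit using (⊤; tt)
open import Relation.Nullary using (¬_; Dec; yes; no; does)
open import Relation.Nullary.Decidable
  using (_×-dec_; _⊎-dec_; ¬?; map′; decidable-stable; from-yes)
open import Relation.Binary.Definitions using (tri<; tri≈; tri>)
open import Relation.Binary.PropositionalEquality
  using (_≡_; _≢_; refl; sym; trans; cong; cong₂; subst; subst₂; module ≡-Reasoning)
open import Function using (_∘_; id)
open import Function.Bundles using (_⇔_; mk⇔; mk↔ₛ′; Inverse; Equivalence)
import Function.Properties.Equivalence as Iff

ind : Bool → ℕ
ind b = if b then 1 else 0

count : ∀ {n} → (Fin n → Bool) → ℕ
count {zero}  P = 0
count {suc n} P = ind (P zero) + count (P ∘ suc)

sum-tabulate : ∀ {k n} (P : Fin n → Bool) (h : Fin k → Fin n) →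
               sum (map (ind ∘ P) (tabulate h)) ≡ count (P ∘ h)
sum-tabulate {zero}  P h = refl
sum-tabulate {suc k} P h = cong (ind (P (h zero)) +_) (sum-tabulate P (h ∘ suc))

remove : ∀ {n} → (Fin n → Bool) → Fin n → Fin n → Bool
remove P a y = not (does (y ≟ a)) ∧ P y

remove-true : ∀ {n} (P : Fin n → Bool) {a y} → P y ≡ true → y ≢ a → remove P a y ≡ true
remove-true P {a} {y} py y≢a with y ≟ a
... | yes y≡a = ⊥-elim (y≢a y≡a)
... | no _    = py

remove-sound : ∀ {n} (P : Fin n → Bool) {a y} → remove P a y ≡ true → P y ≡ true × y ≢ a
remove-sound P {a} {y} e with y ≟ a
... | no y≢a = e , y≢a

count-remove : ∀ {n} (P : Fin n → Bool) a → count P ≡ ind (P a) + count (remove P a)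
count-remove {suc n} P zero    = refl
count-remove {suc n} P (suc a) = begin
  ind (P zero) + count (P ∘ suc)
    ≡⟨ cong (ind (P zero) +_) (count-remove (P ∘ suc) a) ⟩
  ind (P zero) + (ind (P (suc a)) + count (remove (P ∘ suc) a))
    ≡⟨ sym (+-assoc (ind (P zero)) _ _) ⟩
  (ind (P zero) + ind (P (suc a))) + count (remove (P ∘ suc) a)
    ≡⟨ cong (_+ count (remove (P ∘ suc) a)) (+-comm (ind (P zero)) _) ⟩
  (ind (P (suc a)) + ind (P zero)) + count (remove (P ∘ suc) a)
    ≡⟨ +-assoc (ind (P (suc a))) _ _ ⟩
  ind (P (suc a)) + (ind (P zero) + count (remove (P ∘ suc) a)) ∎
  where open ≡-Reasoning

count-false : ∀ {n} (P : Fin n → Bool) → (∀ y → P y ≡ false) → count P ≡ 0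
count-false {zero}  P none = refl
count-false {suc n} P none rewrite none zero = count-false (P ∘ suc) (none ∘ suc)

ind≤1 : ∀ b → ind b ≤ 1
ind≤1 true  = s≤s z≤n
ind≤1 false = z≤n

count-lower : ∀ {n} (P : Fin n → Bool) (xs : List (Fin n)) → Unique xs →
              All (λ a → P a ≡ true) xs → length xs ≤ count P
count-lower P []       _              _          = z≤n
count-lower P (a ∷ xs) (a∉xs ∷ uniq) (pa ∷ pxs) rewrite count-remove P a | pa =
  s≤s (count-lower (remove P a) xs uniq
        (All.zipWith (λ (a≢y , py) → remove-true P py (a≢y ∘ sym)) (a∉xs , pxs)))

count-upper : ∀ {n} (P : Fin n → Bool) (xs : List (Fin n)) →
              (∀ y → P y ≡ true → y ∈ xs) → count P ≤ length xs
count-upper P [] within = ≤-reflexive (count-false P none)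
  where
  none : ∀ y → P y ≡ false
  none y with P y in py
  ... | false = refl
  ... | true with within y py
  ... | ()
count-upper P (a ∷ xs) within rewrite count-remove P a =
  +-mono-≤ (ind≤1 (P a)) (count-upper (remove P a) xs within′)
  where
  within′ : ∀ y → remove P a y ≡ true → y ∈ xs
  within′ y e with remove-sound P e
  ... | py , y≢a with within y py
  ... | here y≡a = ⊥-elim (y≢a y≡a)
  ... | there y∈xs = y∈xs

count-true : ∀ n → count {n} (λ _ → true) ≡ n
count-true zero    = refl
count-true (suc n) = cong suc (count-true n)

_∈?_ : ∀ {n} (z : Fin n) (xs : List (Fin n)) → Dec (z ∈ xs)
z ∈? xs = Any.any? (z ≟_) xs

missed-point : ∀ {n} (xs : List (Fin n)) → length xs < n → Σ (Fin n) λ z → z ∉ xs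
missed-point {n} xs short with any? (λ z → ¬? (z ∈? xs))
... | yes missed = missed
... | no  none   = ⊥-elim (<⇒≱ short (subst (_≤ length xs) (count-true n)
                                     (count-upper (λ _ → true) xs covered)))
  where
  covered : ∀ z → true ≡ true → z ∈ xs
  covered z _ = decidable-stable (z ∈? xs) (λ z∉ → none (z , z∉))

module _ {n : ℕ} (G : Graph n) where

  Adj-sym : ∀ {x y} → Adj G x y → Adj G y x
  Adj-sym {x} {y} e = trans (adj-sym G y x) e

  Adj-irrefl : ∀ {x y} → Adj G x y → x ≢ y
  Adj-irrefl {x} e refl with trans (sym e) (adj-irrefl G x)
  ... | ()

  degree≡count : ∀ v → degree G v ≡ count (adj G v)
  degree≡count v = sum-tabulate (adj G v) id

  degree-lower : ∀ {v} xs → Unique xs → All (Adj G v) xs → length xs ≤ degree G v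
  degree-lower {v} xs uniq nbrs rewrite degree≡count v = count-lower (adj G v) xs uniq nbrs

  degree-upper : ∀ {v} xs → (∀ w → Adj G v w → w ∈ xs) → degree G v ≤ length xs
  degree-upper {v} xs within rewrite degree≡count v = count-upper (adj G v) xs within

  degree-exact : ∀ {v} xs → Unique xs → All (Adj G v) xs → (∀ w → Adj G v w → w ∈ xs) →
                 degree G v ≡ length xs
  degree-exact xs uniq nbrs within =
    ≤-antisym (degree-upper xs within) (degree-lower xs uniq nbrs)

  neighbour-outside? : ∀ {Q : Fin n → Set} → (∀ w → Dec (Q w)) → ∀ v →
                       (Σ (Fin n) λ w → Adj G v w × ¬ Q w) ⊎ (∀ w → Adj G v w → Q w)
  neighbour-outside? Q? v with any? (λ w → (adj G v w ≟ᵇ true) ×-dec ¬? (Q? w))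
  ... | yes found = inj₁ found
  ... | no none   = inj₂ λ w e → decidable-stable (Q? w) (λ ¬q → none (w , e , ¬q))

  leaf-unique : ∀ {v a b} → IsLeaf G v → Adj G v a → Adj G v b → a ≡ b
  leaf-unique {v} {a} {b} leaf ea eb with a ≟ b
  ... | yes a≡b = a≡b
  ... | no a≢b = ⊥-elim (1+n≰n (subst (2 ≤_) leaf
                   (degree-lower (a ∷ b ∷ []) ((a≢b ∷ []) ∷ [] ∷ []) (ea ∷ eb ∷ []))))

  reach-start : ∀ {S x y} → ReachIn G S x y → S x
  reach-start (here s)     = s
  reach-start (step s _ _) = s

  reach-end : ∀ {S x y} → ReachIn G S x y → S y
  reach-end (here s)     = s
  reach-end (step _ _ r) = reach-end r

  reach-trans : ∀ {S x y z} → ReachIn G S x y → ReachIn G S y z → ReachIn G S x z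
  reach-trans (here _)     r′ = r′
  reach-trans (step s e r) r′ = step s e (reach-trans r r′)

  reach-snoc : ∀ {S x y z} → ReachIn G S x y → Adj G y z → S z → ReachIn G S x z
  reach-snoc r e s = reach-trans r (step (reach-end r) e (here s))

  reach-rev : ∀ {S x y} → ReachIn G S x y → ReachIn G S y x
  reach-rev (here s)     = here s
  reach-rev (step s e r) = reach-snoc (reach-rev r) (Adj-sym e) s

  reach-mono : ∀ {S S′ : Fin n → Set} {x y} → (∀ {z} → S z → S′ z) →
               ReachIn G S x y → ReachIn G S′ x y
  reach-mono h (here s)     = here (h s)
  reach-mono h (step s e r) = step (h s) e (reach-mono h r)

  reach-invariant : ∀ {S x y} (Q : Fin n → Set) →
                    (∀ {a w} → Q a → S a → Adj G a w → S w → Q w) →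
                    ReachIn G S x y → Q x → Q y
  reach-invariant Q pres (here _)     q = q
  reach-invariant Q pres (step s e r) q = reach-invariant Q pres r (pres q s e (reach-start r))

reach-map : ∀ {n m} (G : Graph n) (H : Graph m) (φ : Fin n → Fin m)
            {S : Fin n → Set} {S′ : Fin m → Set} →
            (∀ {a b} → Adj G a b → Adj H (φ a) (φ b)) → (∀ {z} → S z → S′ (φ z)) →
            ∀ {x y} → ReachIn G S x y → ReachIn H S′ (φ x) (φ y)
reach-map G H φ hom sup (here s)     = here (sup s)
reach-map G H φ hom sup (step s e r) = step (sup s) (hom e) (reach-map G H φ hom sup r)

module _ {n : ℕ} (G : Graph n) where

  -- A path in S from x to y: vertices at 0, …, len, pairwise distinct,
  -- consecutive ones adjacent, all in S (values of `at` beyond len are irrelevant).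
  record Path (S : Fin n → Set) (x y : Fin n) : Set where
    field
      len    : ℕ
      at     : ℕ → Fin n
      start  : at 0 ≡ x
      end    : at len ≡ y
      inj    : ∀ {i j} → i ≤ len → j ≤ len → at i ≡ at j → i ≡ j
      edge   : ∀ {i} → i < len → Adj G (at i) (at (suc i))
      inside : ∀ {i} → i ≤ len → S (at i)

  open Path public

  OnPath : ∀ {S x y} → Path S x y → Fin n → Set
  OnPath p w = Σ ℕ λ i → i ≤ len p × at p i ≡ w

  onPath? : ∀ {S x y} (p : Path S x y) (w : Fin n) → Dec (OnPath p w)
  onPath? p w = map′ (λ (i , i<  , e) → i , ≤-pred i< , e) (λ (i , i≤ , e) → i , s≤s i≤ , e)
                     (anyUpTo? (λ i → at p i ≟ w) (suc (len p)))

  path-mono : ∀ {S S′ : Fin n → Set} {x y} → (∀ {z} → S z → S′ z) → Path S x y → Path S′ x y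
  path-mono h p = record
    { len = len p ; at = at p ; start = start p ; end = end p
    ; inj = inj p ; edge = edge p ; inside = λ i≤ → h (inside p i≤) }

  path-bound : ∀ {S x y} (p : Path S x y) → suc (len p) ≤ n
  path-bound p = injective⇒≤ {f = λ i → at p (toℕ i)}
    (λ eq → toℕ-injective (inj p (≤-pred (toℕ<n _)) (≤-pred (toℕ<n _)) eq))

  single : ∀ {S x} → S x → Path S x x
  single {x = x} s = record
    { len = 0 ; at = λ _ → x ; start = refl ; end = refl
    ; inj = λ { z≤n z≤n _ → refl } ; edge = λ () ; inside = λ _ → s }

  cons : ∀ {S x w y} → S x → Adj G x w → (p : Path S w y) → ¬ OnPath p x → Path S x y
  cons {x = x} s e p fresh = record
    { len = suc (len p) ; at = at′ ; start = refl ; end = end p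
    ; inj = inj′ ; edge = edge′ ; inside = inside′ }
    where
    at′ : ℕ → Fin n
    at′ zero    = x
    at′ (suc i) = at p i
    inj′ : ∀ {i j} → i ≤ suc (len p) → j ≤ suc (len p) → at′ i ≡ at′ j → i ≡ j
    inj′ {zero}  {zero}  _         _         _  = refl
    inj′ {zero}  {suc j} _         (s≤s j≤)  eq = ⊥-elim (fresh (j , j≤ , sym eq))
    inj′ {suc i} {zero}  (s≤s i≤)  _         eq = ⊥-elim (fresh (i , i≤ , eq))
    inj′ {suc i} {suc j} (s≤s i≤)  (s≤s j≤)  eq = cong suc (inj p i≤ j≤ eq)
    edge′ : ∀ {i} → i < suc (len p) → Adj G (at′ i) (at′ (suc i))
    edge′ {zero}  _        = subst (Adj G x) (sym (start p)) e
    edge′ {suc i} (s≤s i<) = edge p i<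
    inside′ : ∀ {i} → i ≤ suc (len p) → _
    inside′ {zero}  _        = s
    inside′ {suc i} (s≤s i≤) = inside p i≤

  suffix : ∀ {S x y} (p : Path S x y) k → k ≤ len p → Path S (at p k) y
  suffix p k k≤ = record
    { len = len p ∸ k
    ; at = λ i → at p (k + i)
    ; start = cong (at p) (+-identityʳ k)
    ; end = trans (cong (at p) (m+[n∸m]≡n k≤)) (end p)
    ; inj = λ i≤ j≤ eq → +-cancelˡ-≡ k _ _ (inj p (shift i≤) (shift j≤) eq)
    ; edge = λ {i} i< → subst (λ j → Adj G (at p (k + i)) (at p j)) (sym (+-suc k i))
                          (edge p (subst (_≤ len p) (+-suc k i) (shift i<)))
    ; inside = λ i≤ → inside p (shift i≤)
    }
    where
    shift : ∀ {i} → i ≤ len p ∸ k → k + i ≤ len p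
    shift i≤ = subst (_ ≤_) (m+[n∸m]≡n k≤) (+-monoʳ-≤ k i≤)

  reverse : ∀ {S x y} → Path S x y → Path S y x
  reverse p = record
    { len = len p
    ; at = λ i → at p (len p ∸ i)
    ; start = end p
    ; end = trans (cong (at p) (n∸n≡0 (len p))) (start p)
    ; inj = λ {i} {j} i≤ j≤ eq → ∸-cancelˡ-≡ i≤ j≤ (inj p (m∸n≤m _ i) (m∸n≤m _ j) eq)
    ; edge = λ {i} i< → Adj-sym G (subst (λ j → Adj G (at p (len p ∸ suc i)) (at p j))
                          (back i<) (edge p (subst (_≤ len p) (sym (back i<)) (m∸n≤m _ i))))
    ; inside = λ {i} _ → inside p (m∸n≤m _ i)
    }
    where
    back : ∀ {i} → i < len p → suc (len p ∸ suc i) ≡ len p ∸ i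
    back i< = sym (+-∸-assoc 1 i<)

  onPath-reverse : ∀ {S x y} (p : Path S x y) {w} → OnPath p w → OnPath (reverse p) w
  onPath-reverse p (i , i≤ , e) = len p ∸ i , m∸n≤m _ i , trans (cong (at p) (m∸[m∸n]≡n i≤)) e

  onPath-unreverse : ∀ {S x y} (p : Path S x y) {w} → OnPath (reverse p) w → OnPath p w
  onPath-unreverse p (i , i≤ , e) = len p ∸ i , m∸n≤m _ i , e

  snoc : ∀ {S x y w} (p : Path S x y) → Adj G y w → S w → ¬ OnPath p w → Path S x w
  snoc p e s fresh = reverse (cons s (Adj-sym G e) (reverse p) (fresh ∘ onPath-unreverse p))

  snoc-prefix : ∀ {S x y w} (p : Path S x y) (e : Adj G y w) (s : S w) fresh →
                ∀ {i} → i ≤ len p → at (snoc p e s fresh) i ≡ at p i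
  snoc-prefix {x = x} {w = w} p e s fresh {i} i≤ = begin
    at (reverse q) i           ≡⟨ cong (at q) (+-∸-assoc 1 i≤) ⟩
    at p (len p ∸ (len p ∸ i)) ≡⟨ cong (at p) (m∸[m∸n]≡n i≤) ⟩
    at p i                     ∎
    where
    open ≡-Reasoning
    q : Path _ w x
    q = cons s (Adj-sym G e) (reverse p) (fresh ∘ onPath-unreverse p)

  walk→path : ∀ {S x y} → ReachIn G S x y → Path S x y
  walk→path (here s) = single s
  walk→path {x = x} (step s e r) with walk→path r
  ... | p with onPath? p x
  ...   | yes (k , k≤ , at≡x) = subst (λ v → Path _ v _) at≡x (suffix p k k≤)
  ...   | no fresh            = cons s e p fresh

  path→walk : ∀ {S S′ x y} (p : Path S x y) {i j} → i ≤ j → j ≤ len p →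
              (∀ {k} → i ≤ k → k ≤ j → S′ (at p k)) → ReachIn G S′ (at p i) (at p j)
  path→walk p {j = zero}  z≤n _  sup = here (sup z≤n z≤n)
  path→walk p {j = suc j} i≤ j< sup with m≤n⇒m<n∨m≡n i≤
  ... | inj₂ refl      = here (sup ≤-refl ≤-refl)
  ... | inj₁ (s≤s i≤j) =
    reach-snoc G (path→walk p i≤j (<⇒≤ j<) (λ i≤k k≤j → sup i≤k (m≤n⇒m≤1+n k≤j)))
                 (edge p j<) (sup (m≤n⇒m≤1+n i≤j) ≤-refl)

  chord-cycle : ∀ {S x y} (p : Path S x y) i d → 2 ≤ d → i + d ≤ len p →
                Adj G (at p (i + d)) (at p i) → Cycle G
  chord-cycle p i d 2≤d i+d≤ chord = record
    { len = suc d
    ; len≥3 = s≤s 2≤d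
    ; vtx = λ r → at p (i + toℕ r)
    ; vtx-inj = λ eq → toℕ-injective (+-cancelˡ-≡ i _ _ (inj p (within _) (within _) eq))
    ; consec = λ r r′ r+1≡r′ →
        subst (λ k → Adj G (at p (i + toℕ r)) (at p k)) (trans (sym (+-suc i _)) (cong (i +_) r+1≡r′))
          (edge p (subst (_≤ len p) (trans (cong (i +_) (sym r+1≡r′)) (+-suc i _)) (within r′)))
    ; closing = λ r r′ r+1≡len r′≡0 →
        subst₂ (λ a b → Adj G (at p a) (at p b))
          (cong (i +_) (sym (suc-injective r+1≡len)))
          (trans (sym (+-identityʳ i)) (cong (i +_) (sym r′≡0))) chord
    }
    where
    within : ∀ (r : Fin (suc d)) → i + toℕ r ≤ len p
    within r = ≤-trans (+-monoʳ-≤ i (≤-pred (toℕ<n r))) i+d≤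

  induced : ∀ {S x y} → Acyclic G → (p : Path S x y) → ∀ {i j} → i < j → j ≤ len p →
            Adj G (at p j) (at p i) → j ≡ suc i
  induced ac p {i} {j} i<j j≤ chord with m≤n⇒m<n∨m≡n i<j
  ... | inj₂ j≡ = sym j≡
  ... | inj₁ i+2≤j = ⊥-elim (ac (chord-cycle p i (j ∸ i) (m+n≤o⇒m≤o∸n 2 i+2≤j)
                                   (subst (_≤ len p) (sym (m+[n∸m]≡n (<⇒≤ i<j))) j≤)
                                   (subst (λ k → Adj G (at p k) (at p i)) (sym (m+[n∸m]≡n (<⇒≤ i<j))) chord)))

  induced-sym : ∀ {S x y} → Acyclic G → (p : Path S x y) → ∀ {i j} → i ≤ len p → j ≤ len p →
                Adj G (at p i) (at p j) → (j ≡ suc i) ⊎ (i ≡ suc j)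
  induced-sym ac p {i} {j} i≤ j≤ e with <-cmp i j
  ... | tri< i<j _ _ = inj₁ (induced ac p i<j j≤ (Adj-sym G e))
  ... | tri≈ _ refl _ = ⊥-elim (Adj-irrefl G e refl)
  ... | tri> _ _ j<i = inj₂ (induced ac p j<i i≤ e)

  Path₀ : Fin n → Fin n → Set
  Path₀ = Path (λ _ → ⊤)

  record MaximalExtension {x y : Fin n} (p : Path₀ x y) : Set where
    field
      {last}  : Fin n
      path    : Path₀ x last
      longer  : len p ≤ len path
      prefix  : ∀ {i} → i ≤ len p → at path i ≡ at p i
      maximal : ∀ {w} → Adj G last w → OnPath path w

  -- extend greedily; the fuel bounds the number of vertices still available
  extend : ∀ fuel {x y} (p : Path₀ x y) → n ≤ len p + fuel → MaximalExtension p
  extend zero p n≤ = ⊥-elim (1+n≰n (≤-trans (path-bound p) (subst (n ≤_) (+-identityʳ _) n≤)))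
  extend (suc fuel) {y = y} p n≤ with neighbour-outside? G (onPath? p) y
  ... | inj₁ (w , e , fresh) = record
    { path = path ext
    ; longer = ≤-trans (n≤1+n _) (longer ext)
    ; prefix = λ i≤ → trans (prefix ext (m≤n⇒m≤1+n i≤)) (snoc-prefix p e tt fresh i≤)
    ; maximal = maximal ext
    }
    where
    open MaximalExtension
    ext : MaximalExtension (snoc p e tt fresh)
    ext = extend fuel (snoc p e tt fresh) (subst (n ≤_) (+-suc _ fuel) n≤)
  ... | inj₂ stuck = record
    { path = p ; longer = ≤-refl ; prefix = λ _ → refl ; maximal = λ {w} e → stuck w e }

  -- n units of fuel always suffice, since a path has at most n vertices
  maximalExtension : ∀ {x y} (p : Path₀ x y) → MaximalExtension p
  maximalExtension p = extend n p (m≤n+m n (len p))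

  along : ∀ {S S′ x y} (p : Path S x y) → (∀ {i} → i ≤ len p → S′ (at p i)) → ReachIn G S′ x y
  along p sup = subst₂ (ReachIn G _) (start p) (end p) (path→walk p z≤n ≤-refl (λ _ i≤ → sup i≤))

module _ {n : ℕ} {G : Graph n} where

  path-length≥2 : ∀ {S x y} (p : Path G S x y) → ¬ ClosedNbhd G x y → 2 ≤ len p
  path-length≥2 p far with len p | end p | edge p
  ... | zero        | at0≡y | _    = ⊥-elim (far (inj₁ (trans (sym at0≡y) (start p))))
  ... | suc zero    | at1≡y | edge = ⊥-elim (far (inj₂ (subst₂ (Adj G) (start p) at1≡y (edge ≤-refl))))
  ... | suc (suc _) | _     | _    = s≤s (s≤s z≤n)

  apart : ∀ {S x y} → Acyclic G → (p : Path G S x y) → ∀ {i j} → 2 + i ≤ j → j ≤ len p →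
          ¬ ClosedNbhd G (at p i) (at p j)
  apart ac p {i} i+2≤j j≤ (inj₁ at≡) with inj p j≤ (≤-trans (m≤n+m i 2) (≤-trans i+2≤j j≤)) at≡
  ... | refl = 1+n≰n (≤-trans (n≤1+n _) i+2≤j)
  apart ac p {i} i+2≤j j≤ (inj₂ e) with induced G ac p (≤-trans (n≤1+n _) i+2≤j) j≤ (Adj-sym G e)
  ... | refl = 1+n≰n i+2≤j

  closedNbhd-sym : ∀ {u x} → ClosedNbhd G u x → ClosedNbhd G x u
  closedNbhd-sym (inj₁ x≡u) = inj₁ (sym x≡u)
  closedNbhd-sym (inj₂ e)   = inj₂ (Adj-sym G e)

  -- two distinct neighbours of v cannot be joined by a walk avoiding v:
  -- the walk, shortened to a path and closed through v, would be a cycle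
  separation : ∀ {S v a b} → Acyclic G → Adj G v a → Adj G v b → a ≢ b →
               (∀ {z} → S z → z ≢ v) → ¬ ReachIn G S a b
  separation {S} {v} {a} {b} ac ea eb a≢b avoids r = a≢b (trivial (suc-injective len+1≡1))
    where
    p : Path G S a b
    p = walk→path G r
    fresh : ¬ OnPath G p v
    fresh (i , i≤ , at≡v) = avoids (inside p i≤) at≡v
    q : Path₀ G a v
    q = snoc G (path-mono G _ p) (Adj-sym G eb) tt fresh
    len+1≡1 : suc (len p) ≡ 1
    len+1≡1 = induced G ac q (s≤s z≤n) ≤-refl
                (subst₂ (Adj G) (sym (end q)) (sym (trans (snoc-prefix G (path-mono G _ p) (Adj-sym G eb) tt fresh z≤n) (start p))) ea)
    trivial : len p ≡ 0 → a ≡ b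
    trivial len≡0 = trans (sym (start p)) (trans (cong (at p) (sym len≡0)) (end p))

  end-leaf : ∀ {S x y} → Acyclic G → (p : Path G S x y) → 1 ≤ len p →
             (∀ {w} → Adj G y w → OnPath G p w) → IsLeaf G y
  end-leaf {y = y} ac p 1≤len maximal = leaf (predecessor 1≤len)
    where
    predecessor : ∀ {m} → 1 ≤ m → Σ ℕ λ k → suc k ≡ m
    predecessor {suc k} _ = k , refl
    leaf : Σ ℕ (λ k → suc k ≡ len p) → IsLeaf G y
    leaf (k , k+1≡len) = degree-exact G (at p k ∷ []) ([] ∷ []) (prev ∷ []) only
      where
      prev : Adj G y (at p k)
      prev = Adj-sym G (subst (Adj G (at p k)) (trans (cong (at p) k+1≡len) (end p))
                              (edge p (≤-reflexive k+1≡len)))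
      -- a neighbour at position i is adjacent to position len p, so i = k
      only : ∀ w → Adj G y w → w ∈ (at p k ∷ [])
      only w e with maximal e
      ... | i , i≤ , at≡w
        with induced-sym G ac p i≤ ≤-refl (subst₂ (Adj G) (sym at≡w) (sym (end p)) (Adj-sym G e))
      ...   | inj₁ len≡i+1 = here (trans (sym at≡w) (cong (at p) (suc-injective (trans (sym len≡i+1) (sym k+1≡len)))))
      ...   | inj₂ refl    = ⊥-elim (1+n≰n i≤)

  -- in a tree, every vertex outside N[t] is joined to a leaf by a walk outside N[t]:
  -- extend a path from t through z as far as possible; its new end is a leaf
  -- and the extension stays at distance ≥ 2 from t
  leaf-reach : IsTree G → ∀ {t z} → ¬ ClosedNbhd G t z →
               Σ (Fin n) λ ℓ → IsLeaf G ℓ × ReachIn G (λ w → ¬ ClosedNbhd G t w) z ℓ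
  leaf-reach (conn , ac) {t} {z} far =
    last M , end-leaf ac P (≤-trans (s≤s z≤n) (longer-than-2)) (maximal M) , walk
    where
    open MaximalExtension
    p₀ : Path₀ G t z
    p₀ = walk→path G (proj₂ conn t z)
    M : MaximalExtension G p₀
    M = maximalExtension G p₀
    P : Path₀ G t (last M)
    P = path M
    2≤k : 2 ≤ len p₀
    2≤k = path-length≥2 p₀ far
    longer-than-2 : 2 ≤ len P
    longer-than-2 = ≤-trans 2≤k (longer M)
    at-0 : at P 0 ≡ t
    at-0 = trans (prefix M z≤n) (start p₀)
    at-k : at P (len p₀) ≡ z
    at-k = trans (prefix M ≤-refl) (end p₀)
    outside : ∀ {j} → len p₀ ≤ j → j ≤ len P → ¬ ClosedNbhd G t (at P j)
    outside {j} k≤j j≤ = subst (λ u → ¬ ClosedNbhd G u (at P j)) at-0 (apart ac P (≤-trans 2≤k k≤j) j≤)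
    walk : ReachIn G (λ w → ¬ ClosedNbhd G t w) z (last M)
    walk = subst₂ (ReachIn G _) at-k (end P) (path→walk G P (longer M) ≤-refl outside)

  TwoNeighboursOn : ∀ {S x y} → Path G S x y → Fin n → Set
  TwoNeighboursOn p v = Σ (Fin n) λ a → Σ (Fin n) λ b →
    a ≢ b × Adj G v a × Adj G v b × OnPath G p a × OnPath G p b

  endpoint-or-interior : ∀ {S x y} (p : Path G S x y) {i} → i ≤ len p →
                         (at p i ≡ x) ⊎ (at p i ≡ y) ⊎ TwoNeighboursOn p (at p i)
  endpoint-or-interior p {zero} _ = inj₁ (start p)
  endpoint-or-interior p {suc j} i≤ with m≤n⇒m<n∨m≡n i≤
  ... | inj₂ refl    = inj₂ (inj₁ (end p))
  ... | inj₁ j+2≤len = inj₂ (inj₂ (at p j , at p (suc (suc j)) , distinct ,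
      Adj-sym G (edge p j<len) , edge p j+2≤len , (j , <⇒≤ j<len , refl) , (suc (suc j) , j+2≤len , refl)))
    where
    j<len : j < len p
    j<len = <⇒≤ j+2≤len
    distinct : at p j ≢ at p (suc (suc j))
    distinct eq with inj p (<⇒≤ j<len) j+2≤len eq
    ... | ()

  leaf-endpoint : ∀ {S x y} (p : Path G S x y) {i} → i ≤ len p → IsLeaf G (at p i) →
                  (at p i ≡ x) ⊎ (at p i ≡ y)
  leaf-endpoint p i≤ leaf with endpoint-or-interior p i≤
  ... | inj₁ first        = inj₁ first
  ... | inj₂ (inj₁ last)  = inj₂ last
  ... | inj₂ (inj₂ (a , b , a≢b , ea , eb , _)) = ⊥-elim (a≢b (leaf-unique G leaf ea eb))

consecutive? : ℕ → ℕ → Bool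
consecutive? a b = (suc a ≡ᵇ b) ∨ (suc b ≡ᵇ a)

consecutive-true : ∀ a b → (consecutive? a b ≡ true) ⇔ ((b ≡ suc a) ⊎ (a ≡ suc b))
consecutive-true a b = mk⇔
  (λ c → ⊎-map (sym ∘ ≡ᵇ⇒≡ _ _) (sym ∘ ≡ᵇ⇒≡ _ _) (Equivalence.to T-∨ (Equivalence.from T-≡ c)))
  (λ e → Equivalence.to T-≡ (Equivalence.from T-∨ (⊎-map (≡⇒≡ᵇ _ _ ∘ sym) (≡⇒≡ᵇ _ _ ∘ sym) e)))

module _ {n : ℕ} {G : Graph n} where

  adjacent-on-path : ∀ {S x y} → Acyclic G → (p : Path G S x y) → ∀ {a b} → a ≤ len p → b ≤ len p →
                     Adj G (at p a) (at p b) ⇔ ((b ≡ suc a) ⊎ (a ≡ suc b))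
  adjacent-on-path ac p a≤ b≤ = mk⇔ (induced-sym G ac p a≤ b≤) forward
    where
    forward : _ → _
    forward (inj₁ refl) = edge p b≤
    forward (inj₂ refl) = Adj-sym G (edge p a≤)

  spanning-path-iso : ∀ {x y} → Acyclic G → (p : Path₀ G x y) → (∀ z → OnPath G p z) →
                      n ≡ suc (len p) × G ≅ pathGraph n
  spanning-path-iso ac p spans = n≡ , mk↔ₛ′ toF fromF to∘from from∘to , preserves
    where
    idx : Fin n → ℕ
    idx z = proj₁ (spans z)
    idx≤ : ∀ z → idx z ≤ len p
    idx≤ z = proj₁ (proj₂ (spans z))
    at-idx : ∀ z → at p (idx z) ≡ z
    at-idx z = proj₂ (proj₂ (spans z))
    idx-injective : ∀ {z z′} → idx z ≡ idx z′ → z ≡ z′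
    idx-injective {z} {z′} eq = trans (sym (at-idx z)) (trans (cong (at p) eq) (at-idx z′))
    -- vertices inject into the positions 0 … len p; the converse is pigeonhole
    n≡ : n ≡ suc (len p)
    n≡ = ≤-antisym
      (injective⇒≤ {f = λ z → fromℕ< (s≤s (idx≤ z))} λ {z} {z′} eq → idx-injective
        (trans (sym (toℕ-fromℕ< (s≤s (idx≤ z)))) (trans (cong toℕ eq) (toℕ-fromℕ< (s≤s (idx≤ z′))))))
      (path-bound G p)
    idx<n : ∀ z → idx z < n
    idx<n z = subst (idx z <_) (sym n≡) (s≤s (idx≤ z))
    toF : Fin n → Fin n
    toF z = fromℕ< (idx<n z)
    fromF : Fin n → Fin n
    fromF i = at p (toℕ i)
    toℕ≤len : ∀ (i : Fin n) → toℕ i ≤ len p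
    toℕ≤len i = ≤-pred (subst (toℕ i <_) n≡ (toℕ<n i))
    to∘from : ∀ i → toF (fromF i) ≡ i
    to∘from i = toℕ-injective (trans (toℕ-fromℕ< (idx<n (fromF i)))
                  (inj p (idx≤ (fromF i)) (toℕ≤len i) (at-idx (fromF i))))
    from∘to : ∀ z → fromF (toF z) ≡ z
    from∘to z = trans (cong (at p) (toℕ-fromℕ< (idx<n z))) (at-idx z)
    preserves : ∀ u v → adj (pathGraph n) (toF u) (toF v) ≡ adj G u v
    preserves u v = begin
      consecutive? (toℕ (toF u)) (toℕ (toF v))  ≡⟨ cong₂ consecutive? (toℕ-fromℕ< (idx<n u)) (toℕ-fromℕ< (idx<n v)) ⟩
      consecutive? (idx u) (idx v)              ≡⟨ ⇔→≡ (Iff.trans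
                                                        (consecutive-true (idx u) (idx v))
                                                        (Iff.sym
                                                          (adjacent-on-path ac p (idx≤ u) (idx≤ v)))) ⟩
      adj G (at p (idx u)) (at p (idx v))       ≡⟨ cong₂ (adj G) (at-idx u) (at-idx v) ⟩
      adj G u v                                 ∎
      where open ≡-Reasoning

  -- three distinct neighbours a, b, c of v in an acyclic graph: N[a] separates b from c
  three-neighbours-cutset : ∀ {v a b c} → Acyclic G → Adj G v a → Adj G v b → Adj G v c →
                            a ≢ b → a ≢ c → b ≢ c → IsFullStarCutset G a
  three-neighbours-cutset {v} {a} ac ea eb ec a≢b a≢c b≢c =
    _ , _ , outside eb a≢b , outside ec a≢c , blocked
    where
    -- a neighbour z ≠ a of v is not adjacent to a: a, v, z would form a triangle
    outside : ∀ {z} → Adj G v z → a ≢ z → ¬ ClosedNbhd G a z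
    outside ez a≢z (inj₁ z≡a) = a≢z (sym z≡a)
    outside ez a≢z (inj₂ e)   = separation ac ea ez a≢z (λ z≢v → z≢v)
      (step (Adj-irrefl G ea ∘ sym) e (here (Adj-irrefl G ez ∘ sym)))
    -- walks outside N[a] avoid v ∈ N[a]
    blocked : ¬ ReachIn G (λ z → ¬ ClosedNbhd G a z) _ _
    blocked = separation ac eb ec b≢c (λ out z≡v → out (inj₂ (subst (Adj G a) (sym z≡v) (Adj-sym G ea))))

  -- on a path with at least five vertices, N[at p 2] separates at p 0 from at p 4:
  -- a walk between them outside N[at p 2], prolonged to at p 1 and at p 3,
  -- would join two neighbours of at p 2 avoiding it
  long-path-cutset : ∀ {S x y} → Acyclic G → (p : Path G S x y) → 4 ≤ len p → IsFullStarCutset G (at p 2)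
  long-path-cutset ac p 4≤len =
    at p 0 , at p 4 , apart ac p ≤-refl (within 2≤4) ∘ closedNbhd-sym {G = G} , apart ac p ≤-refl 4≤len , blocked
    where
    1≤4 : 1 ≤ 4
    1≤4 = s≤s z≤n
    2≤4 : 2 ≤ 4
    2≤4 = s≤s (s≤s z≤n)
    3≤4 : 3 ≤ 4
    3≤4 = s≤s (s≤s (s≤s z≤n))
    within : ∀ {i} → i ≤ 4 → i ≤ len p
    within i≤4 = ≤-trans i≤4 4≤len
    distinct : ∀ {i j} → i ≤ 4 → j ≤ 4 → i ≢ j → at p i ≢ at p j
    distinct i≤4 j≤4 i≢j = i≢j ∘ inj p (within i≤4) (within j≤4)
    off-centre : ∀ {z} → ¬ ClosedNbhd G (at p 2) z → z ≢ at p 2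
    off-centre out z≡ = out (inj₁ z≡)
    blocked : ¬ ReachIn G (λ z → ¬ ClosedNbhd G (at p 2) z) (at p 0) (at p 4)
    blocked r = separation ac (Adj-sym G (edge p (within 2≤4))) (edge p (within 3≤4))
      (distinct 1≤4 3≤4 (λ ())) (λ z≢centre → z≢centre)
      (step (distinct 1≤4 2≤4 (λ ())) (Adj-sym G (edge p (within 1≤4)))
        (reach-snoc G (reach-mono G off-centre r) (Adj-sym G (edge p 4≤len)) (distinct 3≤4 2≤4 (λ ()))))

  record MaximalPath : Set where
    field
      {first last}  : Fin n
      path          : Path₀ G first last
      first-maximal : ∀ {w} → Adj G first w → OnPath G path w
      last-maximal  : ∀ {w} → Adj G last w → OnPath G path w

  maximalPath : Fin n → MaximalPath
  maximalPath v = record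
    { path = path M₂
    ; first-maximal = λ e → let (i , i≤ , at≡w) = onPath-reverse G (path M₁) (maximal M₁ e)
                            in i , ≤-trans i≤ (longer M₂) , trans (prefix M₂ i≤) at≡w
    ; last-maximal = maximal M₂
    }
    where
    open MaximalExtension
    M₁ : MaximalExtension G (single G {x = v} tt)
    M₁ = maximalExtension G (single G {x = v} tt)
    M₂ : MaximalExtension G (reverse G (path M₁))
    M₂ = maximalExtension G (reverse G (path M₁))

  NoThreeNeighbours : Set
  NoThreeNeighbours = ∀ {v a b c} → Adj G v a → Adj G v b → Adj G v c → a ≢ b → a ≢ c → b ≢ c → ⊥

  -- in a connected graph of maximum degree ≤ 2 a maximal path visits every vertex:
  -- being on it is preserved along edges, since inner vertices have both
  -- their neighbours on it and the ends are maximal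
  maximal-path-spans : Connected G → NoThreeNeighbours → (P : MaximalPath) →
                       ∀ z → OnPath G (MaximalPath.path P) z
  maximal-path-spans conn no3 P z = reach-invariant G (OnPath G p) closed (proj₂ conn (at p 0) z) (0 , z≤n , refl)
    where
    open MaximalPath P renaming (path to p)
    closed : ∀ {a w} → OnPath G p a → ⊤ → Adj G a w → ⊤ → OnPath G p w
    closed {w = w} (i , i≤ , refl) _ e _ with onPath? G p w
    ... | yes on = on
    ... | no off with endpoint-or-interior p i≤
    ...   | inj₁ at≡first       = first-maximal (subst (λ u → Adj G u w) at≡first e)
    ...   | inj₂ (inj₁ at≡last) = last-maximal (subst (λ u → Adj G u w) at≡last e)
    ...   | inj₂ (inj₂ (a , b , a≢b , ea , eb , a-on , b-on)) =
      ⊥-elim (no3 ea eb e a≢b (λ a≡w → off (subst (OnPath G p) a≡w a-on))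
                              (λ b≡w → off (subst (OnPath G p) b≡w b-on)))

  cutset-free-tree-is-small-path : IsTree G → ¬ HasFullStarCutset G → n ≤ 4 × G ≅ pathGraph n
  cutset-free-tree-is-small-path (conn , ac) cutset-free =
    subst (_≤ 4) (sym (proj₁ spanned)) (s≤s short) , proj₂ spanned
    where
    P : MaximalPath
    P = maximalPath (proj₁ conn)
    open MaximalPath P using () renaming (path to p)
    no3 : NoThreeNeighbours
    no3 ea eb ec a≢b a≢c b≢c = cutset-free (_ , three-neighbours-cutset ac ea eb ec a≢b a≢c b≢c)
    short : len p ≤ 3
    short with ≤-<-connex (len p) 3
    ... | inj₁ ≤3 = ≤3
    ... | inj₂ 3< = ⊥-elim (cutset-free (_ , long-path-cutset ac p 3<))
    spanned : n ≡ suc (len p) × G ≅ pathGraph n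
    spanned = spanning-path-iso ac p (maximal-path-spans conn no3 P)

module _ {n : ℕ} (G : Graph n) where

  OutsideClique : Set
  OutsideClique = ∀ u x y → ClosedNbhd G u x ⊎ ClosedNbhd G u y ⊎ x ≡ y ⊎ Adj G x y

  outsideClique? : Dec OutsideClique
  outsideClique? = all? λ u → all? λ x → all? λ y →
    closedNbhd? u x ⊎-dec closedNbhd? u y ⊎-dec (x ≟ y) ⊎-dec (adj G x y ≟ᵇ true)
    where
    closedNbhd? : ∀ u x → Dec (ClosedNbhd G u x)
    closedNbhd? u x = (x ≟ u) ⊎-dec (adj G u x ≟ᵇ true)

  outsideClique⇒cutset-free : OutsideClique → ¬ HasFullStarCutset G
  outsideClique⇒cutset-free clique (u , x , y , x-out , y-out , blocked) with clique u x y
  ... | inj₁ x-in                = x-out x-in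
  ... | inj₂ (inj₁ y-in)         = y-out y-in
  ... | inj₂ (inj₂ (inj₁ refl))  = blocked (here x-out)
  ... | inj₂ (inj₂ (inj₂ e))     = blocked (step x-out e (here y-out))

outsideClique-pullback : ∀ {n m} (G : Graph n) (H : Graph m) → G ≅ H → OutsideClique H → OutsideClique G
outsideClique-pullback G H (φ , preserves) clique u x y =
  ⊎-map closed (⊎-map closed (⊎-map injective adjacent)) (clique (to u) (to x) (to y))
  where
  open Inverse φ
  injective : ∀ {a b} → to a ≡ to b → a ≡ b
  injective {a} {b} eq = trans (sym (strictlyInverseʳ a)) (trans (cong from eq) (strictlyInverseʳ b))
  adjacent : ∀ {a b} → Adj H (to a) (to b) → Adj G a b
  adjacent {a} {b} e = trans (sym (preserves a b)) e
  closed : ∀ {a} → ClosedNbhd H (to u) (to a) → ClosedNbhd G u a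
  closed = ⊎-map injective adjacent

small-path-clique : ∀ n → n ≤ 4 → OutsideClique (pathGraph n)
small-path-clique 0 _ = from-yes (outsideClique? (pathGraph 0))
small-path-clique 1 _ = from-yes (outsideClique? (pathGraph 1))
small-path-clique 2 _ = from-yes (outsideClique? (pathGraph 2))
small-path-clique 3 _ = from-yes (outsideClique? (pathGraph 3))
small-path-clique 4 _ = from-yes (outsideClique? (pathGraph 4))
small-path-clique (suc (suc (suc (suc (suc _))))) (s≤s (s≤s (s≤s (s≤s ()))))

small-path-cutset-free : ∀ {n} (G : Graph n) → n ≤ 4 × G ≅ pathGraph n → ¬ HasFullStarCutset G
small-path-cutset-free {n} G (n≤4 , iso) =
  outsideClique⇒cutset-free G (outsideClique-pullback G (pathGraph n) iso (small-path-clique n n≤4))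

edge-not-component : ∀ {n} {G : Graph n} {x y} → Connected G → 3 ≤ n →
                     (∀ {w} → Adj G x w → w ≡ y) → (∀ {w} → Adj G y w → w ≡ x) → ⊥
edge-not-component {G = G} {x} {y} conn 3≤n x-only y-only with missed-point (x ∷ y ∷ []) 3≤n
... | z , z∉ = z∉ (reach-invariant G (_∈ (x ∷ y ∷ [])) closed (proj₂ conn x z) (here refl))
  where
  closed : ∀ {a w} → a ∈ (x ∷ y ∷ []) → ⊤ → Adj G a w → ⊤ → w ∈ (x ∷ y ∷ [])
  closed (here refl)         _ e _ = there (here (x-only e))
  closed (there (here refl)) _ e _ = here (y-only e)

module _ {m : ℕ} {T : Graph m} where

  private
    C : Graph (suc m)
    C = chandelier T

  leaf→pivot : ∀ {j} → IsLeaf T j → Adj C zero (suc j)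
  leaf→pivot leaf rewrite leaf = refl

  pivot→leaf : ∀ {j} → Adj C zero (suc j) → IsLeaf T j
  pivot→leaf e = ≡ᵇ⇒≡ _ _ (Equivalence.from T-≡ e)

  lift : ∀ {S : Fin m → Set} {S′ : Fin (suc m) → Set} → (∀ {z} → S z → S′ (suc z)) →
         ∀ {a b} → ReachIn T S a b → ReachIn C S′ (suc a) (suc b)
  lift = reach-map T C suc (λ e → e)

  lower : ∀ {S : Fin (suc m) → Set} → ¬ S zero → ∀ {a b} →
          ReachIn C S (suc a) (suc b) → ReachIn T (S ∘ suc) a b
  lower no-pivot (here s) = here s
  lower no-pivot (step {y = zero}  s e r) = ⊥-elim (no-pivot (reach-start C r))
  lower no-pivot (step {y = suc _} s e r) = step s e (lower no-pivot r)

  closed-lift : ∀ {t z} → ClosedNbhd T t z → ClosedNbhd C (suc t) (suc z)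
  closed-lift = ⊎-map (cong suc) id

  closed-lower : ∀ {t z} → ClosedNbhd C (suc t) (suc z) → ClosedNbhd T t z
  closed-lower = ⊎-map Finₚ.suc-injective id

  -- if the neighbour y of a leaf x has two further neighbours a ≠ b, then
  -- N_C[x] separates a from b: avoiding x and the pivot, a walk from a to b
  -- must avoid y, contradicting acyclicity
  leaf-neighbour-cutset : ∀ {x y a b} → Acyclic T → IsLeaf T x → Adj T x y →
                          Adj T y a → Adj T y b → a ≢ x → b ∉ (x ∷ a ∷ []) →
                          IsFullStarCutset C (suc x)
  leaf-neighbour-cutset {x} {y} {a} {b} ac leaf exy eya eyb a≢x b∉ =
    suc a , suc b , outside eya a≢x , outside eyb (b∉ ∘ here) , blocked
    where
    outside : ∀ {z} → Adj T y z → z ≢ x → ¬ ClosedNbhd C (suc x) (suc z)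
    outside eyz z≢x (inj₁ eq) = z≢x (Finₚ.suc-injective eq)
    outside eyz z≢x (inj₂ exz) with leaf-unique T leaf exz exy
    ... | refl = Adj-irrefl T eyz refl
    blocked : ¬ ReachIn C (λ z → ¬ ClosedNbhd C (suc x) z) (suc a) (suc b)
    blocked r = separation ac eya eyb (b∉ ∘ there ∘ here ∘ sym)
      (λ out z≡y → out (inj₂ (subst (Adj T x) (sym z≡y) exy)))
      (lower (λ out → out (inj₂ (leaf→pivot {j = x} leaf))) r)

  cutset-free⇒luxury : IsTree T → 3 ≤ m → ¬ HasFullStarCutset C → Luxury T
  cutset-free⇒luxury (conn , ac) 3≤m cutset-free x y leaf exy with neighbour-outside? T (_≟ x) y
  ... | inj₂ only-x = ⊥-elim (edge-not-component conn 3≤m (λ e → leaf-unique T leaf e exy) (only-x _))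
  ... | inj₁ (a , eya , a≢x) with neighbour-outside? T (_∈? (x ∷ a ∷ [])) y
  ...   | inj₂ within = degree-exact T (x ∷ a ∷ []) (((a≢x ∘ sym) ∷ []) ∷ [] ∷ [])
                                      (Adj-sym T exy ∷ eya ∷ []) within
  ...   | inj₁ (b , eyb , b∉) = ⊥-elim (cutset-free (suc x , leaf-neighbour-cutset ac leaf exy eya eyb a≢x b∉))

  -- N_C[pivot] is no cutset: two non-leaves of T are joined by a path of T,
  -- and a leaf can only be an end of a path
  pivot-not-cutset : IsTree T → ¬ IsFullStarCutset C zero
  pivot-not-cutset _ (zero , _ , x-out , _) = x-out (inj₁ refl)
  pivot-not-cutset _ (suc _ , zero , _ , y-out , _) = y-out (inj₁ refl)
  pivot-not-cutset (conn , _) (suc x , suc y , x-out , y-out , blocked) =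
    blocked (lift off-pivot (along T p nonleaf))
    where
    off-pivot : ∀ {z} → ¬ IsLeaf T z → ¬ ClosedNbhd C zero (suc z)
    off-pivot _       (inj₁ ())
    off-pivot nonleaf (inj₂ e) = nonleaf (pivot→leaf e)
    p : Path₀ T x y
    p = walk→path T (proj₂ conn x y)
    nonleaf : ∀ {i} → i ≤ len p → ¬ IsLeaf T (at p i)
    nonleaf i≤ leaf with leaf-endpoint p i≤ leaf
    ... | inj₁ at≡x = x-out (inj₂ (leaf→pivot (subst (IsLeaf T) at≡x leaf)))
    ... | inj₂ at≡y = y-out (inj₂ (leaf→pivot (subst (IsLeaf T) at≡y leaf)))

  -- when t is a leaf whose neighbour has degree 2, a path of T between vertices
  -- outside N[t] stays outside N[t]: t can only be an end of a path, and the
  -- neighbour of t, having no third neighbour, could only be passed via t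
  leaf-nbhd-avoided : ∀ {t S x y} → Luxury T → IsLeaf T t → (p : Path T S x y) →
                      ¬ ClosedNbhd T t x → ¬ ClosedNbhd T t y →
                      ∀ {i} → i ≤ len p → ¬ ClosedNbhd T t (at p i)
  leaf-nbhd-avoided {t} lux leaf p x-out y-out {i} i≤ = avoided
    where
    t-off : ¬ OnPath T p t
    t-off (j , j≤ , at≡t) with leaf-endpoint p j≤ (subst (IsLeaf T) (sym at≡t) leaf)
    ... | inj₁ at≡x = x-out (inj₁ (trans (sym at≡x) at≡t))
    ... | inj₂ at≡y = y-out (inj₁ (trans (sym at≡y) at≡t))
    avoided : ¬ ClosedNbhd T t (at p i)
    avoided (inj₁ at≡t) = t-off (i , i≤ , at≡t)
    avoided (inj₂ e) with endpoint-or-interior p i≤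
    ... | inj₁ at≡x        = x-out (inj₂ (subst (Adj T t) at≡x e))
    ... | inj₂ (inj₁ at≡y) = y-out (inj₂ (subst (Adj T t) at≡y e))
    ... | inj₂ (inj₂ (a , b , a≢b , ea , eb , a-on , b-on))
      with subst (3 ≤_) (lux t (at p i) leaf e)
             (degree-lower T (t ∷ a ∷ b ∷ []) ((t≢ a-on ∷ t≢ b-on ∷ []) ∷ (a≢b ∷ []) ∷ [] ∷ [])
                             (Adj-sym T e ∷ ea ∷ eb ∷ []))
      where
      t≢ : ∀ {w} → OnPath T p w → t ≢ w
      t≢ w-on refl = t-off w-on
    ... | s≤s (s≤s ())

  -- N_C[t] for a leaf t of a luxury tree: the pivot is adjacent to t, and the
  -- remaining vertices are joined through T as above
  leaf-not-cutset : ∀ {t} → IsTree T → Luxury T → IsLeaf T t → ¬ IsFullStarCutset C (suc t)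
  leaf-not-cutset {t} _ _ leaf (zero , _ , x-out , _) = x-out (inj₂ (leaf→pivot {j = t} leaf))
  leaf-not-cutset {t} _ _ leaf (suc _ , zero , _ , y-out , _) = y-out (inj₂ (leaf→pivot {j = t} leaf))
  leaf-not-cutset {t} (conn , _) lux leaf (suc x , suc y , x-out , y-out , blocked) =
    blocked (lift (λ out → out ∘ closed-lower) (along T p avoided))
    where
    p : Path₀ T x y
    p = walk→path T (proj₂ conn x y)
    avoided : ∀ {i} → i ≤ len p → ¬ ClosedNbhd T t (at p i)
    avoided = leaf-nbhd-avoided lux leaf p (x-out ∘ closed-lift) (y-out ∘ closed-lift)

  -- N_C[t] for a non-leaf t: the pivot is outside it, and every vertex outside
  -- it reaches the pivot through a leaf outside N_T[t]
  nonleaf-not-cutset : ∀ {t} → IsTree T → ¬ IsLeaf T t → ¬ IsFullStarCutset C (suc t)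
  nonleaf-not-cutset {t} tree nonleaf (x , y , x-out , y-out , blocked) =
    blocked (reach-trans C (to-pivot x-out) (reach-rev C (to-pivot y-out)))
    where
    pivot-out : ¬ ClosedNbhd C (suc t) zero
    pivot-out (inj₁ ())
    pivot-out (inj₂ e) = nonleaf (pivot→leaf {j = t} e)
    to-pivot : ∀ {q} → ¬ ClosedNbhd C (suc t) q → ReachIn C (λ z → ¬ ClosedNbhd C (suc t) z) q zero
    to-pivot {zero}  _   = here pivot-out
    to-pivot {suc z} out with leaf-reach tree (out ∘ closed-lift)
    ... | ℓ , leaf , r = reach-snoc C (lift (λ out′ → out′ ∘ closed-lower) r) (leaf→pivot {j = ℓ} leaf) pivot-out

  luxury⇒cutset-free : IsTree T → Luxury T → ¬ HasFullStarCutset C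
  luxury⇒cutset-free tree lux (zero , cut) = pivot-not-cutset tree cut
  luxury⇒cutset-free tree lux (suc t , cut) with degree T t ≟ℕ 1
  ... | yes leaf   = leaf-not-cutset tree lux leaf cut
  ... | no nonleaf = nonleaf-not-cutset tree nonleaf cut

mainTheorem18 :
    (∀ {n : ℕ} (T : Graph n) → IsTree T →
      ((¬ HasFullStarCutset T) ⇔ (n ≤ 4 × (T ≅ pathGraph n))))
    ×
    (∀ {m : ℕ} (T : Graph m) → IsTree T → 3 ≤ m →
      ((¬ HasFullStarCutset (chandelier T)) ⇔ Luxury T))
mainTheorem18 = trees , chandeliers
  where
  trees : ∀ {n : ℕ} (T : Graph n) → IsTree T →
          (¬ HasFullStarCutset T) ⇔ (n ≤ 4 × (T ≅ pathGraph n))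
  trees T tree = mk⇔ (cutset-free-tree-is-small-path tree) (small-path-cutset-free T)
  chandeliers : ∀ {m : ℕ} (T : Graph m) → IsTree T → 3 ≤ m →
                (¬ HasFullStarCutset (chandelier T)) ⇔ Luxury T
  chandeliers T tree 3≤m = mk⇔ (cutset-free⇒luxury tree 3≤m) (luxury⇒cutset-free tree)
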